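{- Define, for positive integers $x,y,z\ge 1$, the polynomials \[ p_1(x,y,z)=x(4yz-1)-yz,\quad p_2(x,y,z)=x(4yz-z-1)-yz,\quad p_3(x,y,z)=x(8y-3)-6y+2,\quad p_4(x,y,z)=x^2-x. \] Then: (a) every odd positive integer equals $p_i(x,y,z)$ for some $i\in\{1,2,3,4\}$ and some positive integers $x,y,z$; (b) every integer of the form $6c+4$ or $6c+2$ with $c\ge 0$ an integer equals $p_i(x,y,z)$ for some $i\in\{1,2,3,4\}$ and some positive integers $x,y,z$.
   Context: $\mathbb{N}^*$ denotes the set of positive integers; the variables $x,y,z$ range over $\mathbb{N}^*$. -}

module Defs where

open import Data.Integer using (ℤ; +_; _+_; _-_; _*_)
open import Data.Nat using (ℕ; suc)
open import Data.Fin using (Fin; zero; suc)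
open import Data.Product using (Σ; _×_; ∃-syntax)

p₁ p₂ p₃ p₄ : ℤ → ℤ → ℤ → ℤ
p₁ x y z = x * (+ 4 * y * z - + 1) - y * z
p₂ x y z = x * (+ 4 * y * z - z - + 1) - y * z
p₃ x y z = x * (+ 8 * y - + 3) - + 6 * y + + 2
p₄ x y z = x * x - x

p : Fin 4 → ℤ → ℤ → ℤ → ℤ
p zero = p₁
p (suc zero) = p₂
p (suc (suc zero)) = p₃
p (suc (suc (suc zero))) = p₄

Represented : ℤ → Set
Represented n = ∃[ i ] ∃[ a ] ∃[ b ] ∃[ c ]
  (p i (+ suc a) (+ suc b) (+ suc c) ≡ n)
  where open import Relation.Binary.PropositionalEquality using (_≡_)

{-# OPTIONS --safe #-}
module Submission where

open import Defs
open import Data.Nat using (ℕ; suc; _+_; _*_)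
open import Data.Integer using (+_)
import Data.Integer as ℤ
open import Data.Integer.Properties using (pos-+; pos-*)
open import Data.Integer.Tactic.RingSolver using (solve-∀)
open import Data.Product using (_×_; _,_)
open import Data.Fin using (zero; suc)
open import Relation.Binary.PropositionalEquality using (_≡_; cong; sym; module ≡-Reasoning)
open ≡-Reasoning

-- Fixing two of the variables at 1 makes p₂ and p₁ linear:
-- p₂(x,1,1) = 2x − 1, p₂(1,y,1) = 3y − 2 and p₁(x,1,1) = 3x − 1.
-- Taking x = k + 1, y = 2c + 2 and x = 2c + 1 gives 2k + 1, 6c + 4 and 6c + 2.

pos-affine : ∀ a n b → + (a * n + b) ≡ + a ℤ.* + n ℤ.+ + b
pos-affine a n b = begin
  + (a * n + b)         ≡⟨ pos-+ (a * n) b ⟩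
  + (a * n) ℤ.+ + b     ≡⟨ cong (ℤ._+ + b) (pos-* a n) ⟩
  + a ℤ.* + n ℤ.+ + b   ∎

p₂-odd : ∀ k → p₂ (+ (1 + k)) (+ 1) (+ 1) ≡ + (2 * k + 1)
p₂-odd k = begin
  p₂ (+ 1 ℤ.+ + k) (+ 1) (+ 1)  ≡⟨ linear (+ k) ⟩
  + 2 ℤ.* + k ℤ.+ + 1           ≡⟨ sym (pos-affine 2 k 1) ⟩
  + (2 * k + 1)                 ∎
  where
  -- solve-∀ does not unfold p₁ or p₂, so each `linear` states the unfolded polynomial.
  linear : ∀ n → (+ 1 ℤ.+ n) ℤ.* + 2 ℤ.- + 1 ≡ + 2 ℤ.* n ℤ.+ + 1
  linear = solve-∀

p₂-4-mod-6 : ∀ c → p₂ (+ 1) (+ (2 + 2 * c)) (+ 1) ≡ + (6 * c + 4)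
p₂-4-mod-6 c = begin
  p₂ (+ 1) (+ 2 ℤ.+ + (2 * c)) (+ 1)     ≡⟨ cong (λ y → p₂ (+ 1) (+ 2 ℤ.+ y) (+ 1)) (pos-* 2 c) ⟩
  p₂ (+ 1) (+ 2 ℤ.+ + 2 ℤ.* + c) (+ 1)   ≡⟨ linear (+ c) ⟩
  + 6 ℤ.* + c ℤ.+ + 4                    ≡⟨ sym (pos-affine 6 c 4) ⟩
  + (6 * c + 4)                          ∎
  where
  linear : ∀ n → let y = + 2 ℤ.+ + 2 ℤ.* n in
           + 1 ℤ.* (+ 4 ℤ.* y ℤ.* + 1 ℤ.- + 1 ℤ.- + 1) ℤ.- y ℤ.* + 1 ≡ + 6 ℤ.* n ℤ.+ + 4
  linear = solve-∀

p₁-2-mod-6 : ∀ c → p₁ (+ (1 + 2 * c)) (+ 1) (+ 1) ≡ + (6 * c + 2)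
p₁-2-mod-6 c = begin
  p₁ (+ 1 ℤ.+ + (2 * c)) (+ 1) (+ 1)     ≡⟨ cong (λ x → p₁ (+ 1 ℤ.+ x) (+ 1) (+ 1)) (pos-* 2 c) ⟩
  p₁ (+ 1 ℤ.+ + 2 ℤ.* + c) (+ 1) (+ 1)   ≡⟨ linear (+ c) ⟩
  + 6 ℤ.* + c ℤ.+ + 2                    ≡⟨ sym (pos-affine 6 c 2) ⟩
  + (6 * c + 2)                          ∎
  where
  linear : ∀ n → (+ 1 ℤ.+ + 2 ℤ.* n) ℤ.* + 3 ℤ.- + 1 ≡ + 6 ℤ.* n ℤ.+ + 2
  linear = solve-∀

theorem1 : ((k : ℕ) → Represented (+ (2 * k + 1)))
    × ((c : ℕ) → Represented (+ (6 * c + 4)) × Represented (+ (6 * c + 2)))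
theorem1 =
    (λ k → suc zero , k , 0 , 0 , p₂-odd k)
  , λ c → (suc zero , 0 , 1 + 2 * c , 0 , p₂-4-mod-6 c)
        , (zero , 2 * c , 0 , 0 , p₁-2-mod-6 c)
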